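{- Let $A\subseteq\mathbb{Z}$. Then $A^{\mathcal{Z}}$ is interdefinable with the expansion of $A^{\mathcal{Z}}_0$ by unary predicates for all sets of the form $A\cap(n\mathbb{Z}+r)$ with integers $0\leq r<n$.
   Context: Let $\mathcal{Z}=(\mathbb{Z},+)$. The $\mathcal{Z}$-induced structure $A^{\mathcal{Z}}$ on $A$ is the structure with universe $A$ having, for each $n\geq1$ and each $\mathcal{Z}$-definable (with parameters) $X\subseteq\mathbb{Z}^n$, an $n$-ary relation interpreted as $A^n\cap X$. For complex numbers $z_1,\ldots,z_k,w$, write $z_1+\cdots+z_k\mathbin{\dot{=}}w$ if $z_1+\cdots+z_k=w$ and $\sum_{i\in I}z_i\neq0$ for every proper nonempty $I\subseteq\{1,\ldots,k\}$. $A^{\mathcal{Z}}_0$ is the reduct of $A^{\mathcal{Z}}$ to the relations $\{\bar a\in A^k:c_1a_1+\cdots+c_ka_k\mathbin{\dot{=}}r\}$ for $k\geq1$, $r\in\mathbb{Z}$, $\bar c\in\{ -1,1\}^k$. Two structures on the same universe are interdefinable if they have the same definable (with parameters) sets. -}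

module Defs where

open import Level using (0ℓ)
open import Data.Nat as ℕ using (ℕ; zero; suc)
open import Data.Integer as ℤ using (ℤ; +_; 0ℤ; 1ℤ; -1ℤ)
open import Data.Fin using (Fin)
open import Data.Bool using (Bool; true; false; if_then_else_)
open import Data.Empty using (⊥)
open import Data.Unit using (⊤)
open import Data.Product using (Σ; Σ-syntax; ∃; ∃-syntax; _×_; _,_; proj₁)
open import Data.Sum using (_⊎_; inj₁; inj₂)
open import Data.Vec.Functional using (Vector; _∷_; _++_; map)
open import Relation.Nullary using (¬_)
open import Relation.Unary using (Pred)
open import Relation.Binary.PropositionalEquality using (_≡_)
open import Function.Bundles using (_⇔_)

-- Generic first-order logic (classical reading: semantics in Set, and the
-- theorem assumes excluded middle).

record Signature : Set₁ where
  field
    Fun    : Set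
    farity : Fun → ℕ
    Rel    : Set
    rarity : Rel → ℕ

module _ (L : Signature) where
  open Signature L

  data Term (n : ℕ) : Set where
    var : Fin n → Term n
    app : (f : Fun) → (Fin (farity f) → Term n) → Term n

  data Formula (n : ℕ) : Set where
    falsum : Formula n
    equal  : Term n → Term n → Formula n
    rel    : (R : Rel) → (Fin (rarity R) → Term n) → Formula n
    neg    : Formula n → Formula n
    conj   : Formula n → Formula n → Formula n
    disj   : Formula n → Formula n → Formula n
    impl   : Formula n → Formula n → Formula n
    exi    : Formula (suc n) → Formula n
    all    : Formula (suc n) → Formula n

  record Structure : Set₁ where
    field
      Carrier : Set
      _≈_     : Carrier → Carrier → Set
      funI    : (f : Fun) → Vector Carrier (farity f) → Carrier
      relI    : (R : Rel) → Vector Carrier (rarity R) → Set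

  module _ (M : Structure) where
    open Structure M

    evalT : ∀ {n} → Term n → Vector Carrier n → Carrier
    evalT (var i)    ρ = ρ i
    evalT (app f ts) ρ = funI f (λ j → evalT (ts j) ρ)

    Sat : ∀ {n} → Formula n → Vector Carrier n → Set
    Sat falsum      ρ = ⊥
    Sat (equal t u) ρ = evalT t ρ ≈ evalT u ρ
    Sat (rel R ts)  ρ = relI R (λ j → evalT (ts j) ρ)
    Sat (neg φ)     ρ = ¬ Sat φ ρ
    Sat (conj φ ψ)  ρ = Sat φ ρ × Sat ψ ρ
    Sat (disj φ ψ)  ρ = Sat φ ρ ⊎ Sat ψ ρ
    Sat (impl φ ψ)  ρ = Sat φ ρ → Sat ψ ρ
    Sat (exi φ)     ρ = Σ[ x ∈ Carrier ] Sat φ (x ∷ ρ)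
    Sat (all φ)     ρ = (x : Carrier) → Sat φ (x ∷ ρ)

    Definable : (k : ℕ) → (Vector Carrier k → Set) → Set
    Definable k X =
      Σ[ m ∈ ℕ ] Σ[ φ ∈ Formula (k ℕ.+ m) ] Σ[ b ∈ Vector Carrier m ]
        ((a : Vector Carrier k) → X a ⇔ Sat φ (a ++ b))

Interdefinable : {L₁ L₂ : Signature} (M : Structure L₁) (N : Structure L₂) →
                 Structure.Carrier M ≡ Structure.Carrier N → Set₁
Interdefinable {L₁} {L₂} M N _≡_.refl =
  (k : ℕ) (X : Vector (Structure.Carrier M) k → Set) →
    Definable L₁ M k X ⇔ Definable L₂ N k X

data ZFun : Set where
  plus : ZFun

ZSig : Signature
ZSig = record { Fun = ZFun ; farity = λ { plus → 2 } ; Rel = ⊥ ; rarity = λ () }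

𝒵 : Structure ZSig
𝒵 = record
  { Carrier = ℤ
  ; _≈_ = _≡_
  ; funI = λ { plus v → v Fin.zero ℤ.+ v (Fin.suc Fin.zero) }
  ; relI = λ ()
  }
  where import Data.Fin as Fin

Elt : Pred ℤ 0ℓ → Set
Elt A = Σ ℤ A

relSig : (R : Set) → (R → ℕ) → Signature
relSig R ar = record { Fun = ⊥ ; farity = λ () ; Rel = R ; rarity = ar }

onA : (A : Pred ℤ 0ℓ) {R : Set} {ar : R → ℕ} →
      ((r : R) → Vector ℤ (ar r) → Set) → Structure (relSig R ar)
onA A I = record
  { Carrier = Elt A
  ; _≈_ = λ x y → proj₁ x ≡ proj₁ y
  ; funI = λ ()
  ; relI = λ r a → I r (map proj₁ a)
  }

-- A^𝒵 : one n-ary relation (n ≥ 1) for each 𝒵-definable X ⊆ ℤ^n,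
-- indexed by a defining formula together with its parameters.
IndSym : Set
IndSym = Σ[ n ∈ ℕ ] Σ[ m ∈ ℕ ] Formula ZSig (suc n ℕ.+ m) × Vector ℤ m

indAr : IndSym → ℕ
indAr (n , _) = suc n

indI : (s : IndSym) → Vector ℤ (indAr s) → Set
indI (n , m , φ , b) a = Sat ZSig 𝒵 φ (a ++ b)

AZ : Pred ℤ 0ℓ → Structure (relSig IndSym indAr)
AZ A = onA A indI

sumℤ : ∀ {k} → Vector ℤ k → ℤ
sumℤ {zero}  z = 0ℤ
sumℤ {suc k} z = z Data.Fin.zero ℤ.+ sumℤ (λ i → z (Data.Fin.suc i))

sumOver : ∀ {k} → (Fin k → Bool) → Vector ℤ k → ℤ
sumOver I z = sumℤ (λ i → if I i then z i else 0ℤ)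

NonDegSum : ∀ {k} → Vector ℤ k → ℤ → Set
NonDegSum {k} z w =
  (sumℤ z ≡ w) ×
  ((I : Fin k → Bool) → (∃[ i ] I i ≡ true) → (∃[ i ] I i ≡ false) →
     ¬ (sumOver I z ≡ 0ℤ))

data Sign : Set where
  pos neg : Sign

signℤ : Sign → ℤ
signℤ pos = 1ℤ
signℤ neg = -1ℤ

-- symbols of A^𝒵_0 : k ≥ 1, r ∈ ℤ, c̄ ∈ {-1,1}^k
Sym0 : Set
Sym0 = Σ[ k ∈ ℕ ] ℤ × Vector Sign (suc k)

ar0 : Sym0 → ℕ
ar0 (k , _) = suc k

I0 : (s : Sym0) → Vector ℤ (ar0 s) → Set
I0 (k , r , c) a = NonDegSum (λ i → signℤ (c i) ℤ.* a i) r

-- congruence predicates: A ∩ (nℤ + r), 0 ≤ r < n  (n = suc n', r : Fin n)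
CongSym : Set
CongSym = Σ[ n ∈ ℕ ] Fin (suc n)

InCongClass : CongSym → ℤ → Set
InCongClass (n , r) a = ∃[ q ] a ≡ + (suc n) ℤ.* q ℤ.+ + (Data.Fin.toℕ r)

Sym0C : Set
Sym0C = Sym0 ⊎ CongSym

ar0C : Sym0C → ℕ
ar0C (inj₁ s) = ar0 s
ar0C (inj₂ _) = 1

I0C : (s : Sym0C) → Vector ℤ (ar0C s) → Set
I0C (inj₁ s) a = I0 s a
I0C (inj₂ s) a = InCongClass s (a Data.Fin.zero)

AZ0C : Pred ℤ 0ℓ → Structure (relSig Sym0C ar0C)
AZ0C A = onA A I0C

-- Presburger arithmetic eliminates quantifiers once linear congruences c·x ≡ r (mod m) are admitted as
-- atoms: a witness y of ∃y φ either solves one of the equations of φ containing y, and can be substituted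
-- away, or it can be moved to its residue modulo the product p of the moduli of φ, since along a residue
-- class far enough out y solves none of these equations. So every 𝒵-definable set is a boolean
-- combination of linear congruences, and it remains to define these in A^𝒵_0 with the predicates
-- A ∩ (nℤ + r). Modulo n ≥ 1 a congruence holds iff it holds for the residues of the variables; an equation,
-- written as a sum ±x_{j₁} ± ⋯ ± x_{jₖ} = r with repetitions, holds iff it holds non-degenerately or some
-- proper part sums to 0 and the rest to r, which gives a recursion on k. Conversely the relations of A^𝒵_0
-- and the predicates A ∩ (nℤ + r) are themselves 𝒵-definable, and definability transfers atom by atom.

module Submission where

open import Defs
open import Level using (0ℓ)
open import Axiom.ExcludedMiddle using (ExcludedMiddle)
open import Data.Nat as ℕ using (ℕ; zero; suc)
import Data.Nat.Properties as ℕP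
open import Relation.Unary using (Pred)
open import Data.Integer as ℤ using (ℤ; +_; -[1+_]; _+_; _*_; _-_; -_; 0ℤ; 1ℤ; -1ℤ; ∣_∣; NonZero)
import Data.Integer.Properties as ℤP
open import Data.Integer.Properties using (i-j≡0⇒i≡j; i≡j⇒i-j≡0)
open import Data.Integer.DivMod using (_%_; _/_; a≡a%n+[a/n]*n; n%d<d)
open import Data.Integer.Tactic.RingSolver using (solve-∀)
open import Data.Fin using (Fin; zero; suc; toℕ; fromℕ<; _↑ˡ_; _↑ʳ_)
import Data.Fin.Properties as FinP
open import Data.Bool using (Bool; true; false; if_then_else_)
open import Data.Empty using (⊥; ⊥-elim)
open import Data.Unit using (⊤; tt)
import Data.Product as Product
open import Data.Product using (Σ-syntax; ∃; ∃-syntax; _×_; _,_; proj₁; proj₂)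
open import Data.Product.Function.NonDependent.Propositional using (_×-⇔_)
open import Data.Sum using (_⊎_; inj₁; inj₂)
open import Data.Sum.Function.Propositional using (_⊎-⇔_)
import Data.List as List
open import Data.List using (List; []; _∷_; _++_; length; replicate; allFin)
open import Data.Nat.ListAction using (sum)
open import Data.List.Relation.Unary.All as All using (All; []; _∷_)
open import Data.List.Relation.Unary.All.Properties using (++⁻ˡ; ++⁻ʳ; ++⁺; map⁺; ¬Any⇒All¬)
open import Data.List.Relation.Unary.Any as Any using (Any; here; there)
open import Data.List.Membership.Propositional using (_∈_)
open import Data.List.Membership.Propositional.Properties using (∈-allFin; ∈-map⁺; ∈-++⁺ˡ; ∈-++⁺ʳ)
open import Data.Vec.Functional using (Vector; tail) renaming (_∷_ to _∷ᵥ_; _++_ to _++ᵥ_; [] to []ᵥ)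
open import Data.Vec.Functional.Properties using (lookup-++ˡ; lookup-++ʳ)
open import Function.Bundles using (_⇔_; mk⇔; Equivalence)
open import Function.Properties.Equivalence using (⇔-isEquivalence; ⇔-setoid)
open import Function.Related.TypeIsomorphisms using (¬-cong-⇔; →-cong-⇔)
open import Relation.Binary.Structures using (IsEquivalence)
open import Relation.Nullary using (¬_; Dec; yes; no; ¬?; _×-dec_)
open import Relation.Nullary.Decidable using (decidable-stable)
open import Function using (_∘_; id; case_of_)
open import Relation.Binary.PropositionalEquality
  using (_≡_; _≢_; refl; sym; trans; cong; cong₂; subst; module ≡-Reasoning)

open Equivalence using (to; from)
module ⇔ = IsEquivalence (⇔-isEquivalence {0ℓ})

∃-⇔ : {A : Set} {P Q : A → Set} → (∀ a → P a ⇔ Q a) → ∃ P ⇔ ∃ Q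
∃-⇔ P⇔Q = mk⇔ (λ (a , p) → a , to (P⇔Q a) p) (λ (a , q) → a , from (P⇔Q a) q)

∀-⇔ : {A : Set} {P Q : A → Set} → (∀ a → P a ⇔ Q a) → (∀ a → P a) ⇔ (∀ a → Q a)
∀-⇔ P⇔Q = mk⇔ (λ p a → to (P⇔Q a) (p a)) (λ q a → from (P⇔Q a) (q a))

infixr 7 _∧ᵖ_
infixr 6 _∨ᵖ_

data Prop (At : Set) : Set where
  ⊤ᵖ ⊥ᵖ     : Prop At
  atom      : At → Prop At
  ¬ᵖ_       : Prop At → Prop At
  _∧ᵖ_ _∨ᵖ_ : Prop At → Prop At → Prop At

module _ {At : Set} where

  ⟦_⟧ : Prop At → (At → Set) → Set
  ⟦ ⊤ᵖ ⟧     P = ⊤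
  ⟦ ⊥ᵖ ⟧     P = ⊥
  ⟦ atom a ⟧ P = P a
  ⟦ ¬ᵖ φ ⟧   P = ¬ ⟦ φ ⟧ P
  ⟦ φ ∧ᵖ ψ ⟧ P = ⟦ φ ⟧ P × ⟦ ψ ⟧ P
  ⟦ φ ∨ᵖ ψ ⟧ P = ⟦ φ ⟧ P ⊎ ⟦ ψ ⟧ P

  atoms : Prop At → List At
  atoms (atom a)  = a ∷ []
  atoms (¬ᵖ φ)    = atoms φ
  atoms (φ ∧ᵖ ψ)  = atoms φ ++ atoms ψ
  atoms (φ ∨ᵖ ψ)  = atoms φ ++ atoms ψ
  atoms _         = []

  ⟦⟧-cong : ∀ (φ : Prop At) {P Q} → All (λ a → P a ⇔ Q a) (atoms φ) → ⟦ φ ⟧ P ⇔ ⟦ φ ⟧ Q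
  ⟦⟧-cong ⊤ᵖ       _           = ⇔.refl
  ⟦⟧-cong ⊥ᵖ       _           = ⇔.refl
  ⟦⟧-cong (atom a) (P⇔Q ∷ []) = P⇔Q
  ⟦⟧-cong (¬ᵖ φ)   P⇔Q         = ¬-cong-⇔ (⟦⟧-cong φ P⇔Q)
  ⟦⟧-cong (φ ∧ᵖ ψ) P⇔Q         = ⟦⟧-cong φ (++⁻ˡ (atoms φ) P⇔Q) ×-⇔ ⟦⟧-cong ψ (++⁻ʳ (atoms φ) P⇔Q)
  ⟦⟧-cong (φ ∨ᵖ ψ) P⇔Q         = ⟦⟧-cong φ (++⁻ˡ (atoms φ) P⇔Q) ⊎-⇔ ⟦⟧-cong ψ (++⁻ʳ (atoms φ) P⇔Q)

  ⟦⟧-cong′ : ∀ (φ : Prop At) {P Q} → (∀ a → P a ⇔ Q a) → ⟦ φ ⟧ P ⇔ ⟦ φ ⟧ Q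
  ⟦⟧-cong′ φ P⇔Q = ⟦⟧-cong φ (All.universal P⇔Q (atoms φ))

  decide : {Q : Set} → Dec Q → Prop At
  decide (yes _) = ⊤ᵖ
  decide (no _)  = ⊥ᵖ

  ⟦decide⟧ : ∀ {Q : Set} (Q? : Dec Q) {P} → ⟦ decide Q? ⟧ P ⇔ Q
  ⟦decide⟧ (yes q) = mk⇔ (λ _ → q) (λ _ → tt)
  ⟦decide⟧ (no ¬q) = mk⇔ (λ ()) ¬q

  ⋁ : {A : Set} → List A → (A → Prop At) → Prop At
  ⋁ []       F = ⊥ᵖ
  ⋁ (x ∷ xs) F = F x ∨ᵖ ⋁ xs F

  ⟦⋁⟧ : ∀ {A : Set} (xs : List A) F {P} → ⟦ ⋁ xs F ⟧ P ⇔ Any (λ x → ⟦ F x ⟧ P) xs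
  ⟦⋁⟧ []       F = mk⇔ (λ ()) (λ ())
  ⟦⋁⟧ (x ∷ xs) F = mk⇔
    (λ { (inj₁ p) → here p ; (inj₂ p) → there (to (⟦⋁⟧ xs F) p) })
    (λ { (here p) → inj₁ p ; (there p) → inj₂ (from (⟦⋁⟧ xs F) p) })

  ⟦⋁allFin⟧ : ∀ n (F : Fin n → Prop At) {P} → ⟦ ⋁ (allFin n) F ⟧ P ⇔ (∃[ i ] ⟦ F i ⟧ P)
  ⟦⋁allFin⟧ n F = ⇔.trans (⟦⋁⟧ (allFin n) F)
    (mk⇔ Any.satisfied (λ (i , p) → Any.map (λ { refl → p }) (∈-allFin i)))

  ⋀subset : ∀ k → ((Fin k → Bool) → Prop At) → Prop At
  ⋀subset zero    F = F (λ ())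
  ⋀subset (suc k) F = ⋀subset k (λ I → F (true ∷ᵥ I) ∧ᵖ F (false ∷ᵥ I))

  -- Functions Fin k → Bool are enumerated only up to pointwise equality, hence the hypothesis on Q.
  ⟦⋀subset⟧ : ∀ k F {P} (Q : (Fin k → Bool) → Set) →
    (∀ {I J} → (∀ i → I i ≡ J i) → Q I → Q J) →
    (∀ I → ⟦ F I ⟧ P ⇔ Q I) → ⟦ ⋀subset k F ⟧ P ⇔ (∀ I → Q I)
  ⟦⋀subset⟧ zero    F Q resp F⇔Q = mk⇔ (λ p I → resp (λ ()) (to (F⇔Q _) p)) (λ q → from (F⇔Q _) (q _))
  ⟦⋀subset⟧ (suc k) F Q resp F⇔Q = ⇔.trans
    (⟦⋀subset⟧ k _ (λ I → Q (true ∷ᵥ I) × Q (false ∷ᵥ I))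
      (λ I≗J → Product.map (resp (cons≗ I≗J)) (resp (cons≗ I≗J)))
      (λ I → F⇔Q _ ×-⇔ F⇔Q _))
    (mk⇔ (λ q I → byHead I (I zero) refl (q (tail I))) (λ q I → q _ , q _))
    where
    cons≗ : ∀ {b} {I J : Fin k → Bool} → (∀ i → I i ≡ J i) → ∀ i → (b ∷ᵥ I) i ≡ (b ∷ᵥ J) i
    cons≗ I≗J zero    = refl
    cons≗ I≗J (suc i) = I≗J i
    byHead : ∀ I b → I zero ≡ b → Q (true ∷ᵥ tail I) × Q (false ∷ᵥ tail I) → Q I
    byHead I true  e (q , _) = resp (λ { zero → sym e ; (suc i) → refl }) q
    byHead I false e (_ , q) = resp (λ { zero → sym e ; (suc i) → refl }) q

_>>=_ : {A B : Set} → Prop A → (A → Prop B) → Prop B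
⊤ᵖ       >>= f = ⊤ᵖ
⊥ᵖ       >>= f = ⊥ᵖ
atom a   >>= f = f a
(¬ᵖ φ)   >>= f = ¬ᵖ (φ >>= f)
(φ ∧ᵖ ψ) >>= f = (φ >>= f) ∧ᵖ (ψ >>= f)
(φ ∨ᵖ ψ) >>= f = (φ >>= f) ∨ᵖ (ψ >>= f)

⟦>>=⟧ : ∀ {A B : Set} (φ : Prop A) (f : A → Prop B) {P} → ⟦ φ >>= f ⟧ P ⇔ ⟦ φ ⟧ (λ a → ⟦ f a ⟧ P)
⟦>>=⟧ ⊤ᵖ       f = ⇔.refl
⟦>>=⟧ ⊥ᵖ       f = ⇔.refl
⟦>>=⟧ (atom a) f = ⇔.refl
⟦>>=⟧ (¬ᵖ φ)   f = ¬-cong-⇔ (⟦>>=⟧ φ f)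
⟦>>=⟧ (φ ∧ᵖ ψ) f = ⟦>>=⟧ φ f ×-⇔ ⟦>>=⟧ ψ f
⟦>>=⟧ (φ ∨ᵖ ψ) f = ⟦>>=⟧ φ f ⊎-⇔ ⟦>>=⟧ ψ f

module _ {L : Signature} {n : ℕ} {At : Set} (f : At → Formula L n) where

  toFormula : Prop At → Formula L n
  toFormula ⊤ᵖ       = neg falsum
  toFormula ⊥ᵖ       = falsum
  toFormula (atom a) = f a
  toFormula (¬ᵖ φ)   = neg (toFormula φ)
  toFormula (φ ∧ᵖ ψ) = conj (toFormula φ) (toFormula ψ)
  toFormula (φ ∨ᵖ ψ) = disj (toFormula φ) (toFormula ψ)

  Sat-toFormula : ∀ (M : Structure L) φ ρ → Sat L M (toFormula φ) ρ ⇔ ⟦ φ ⟧ (λ a → Sat L M (f a) ρ)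
  Sat-toFormula M ⊤ᵖ       ρ = mk⇔ _ (λ _ ())
  Sat-toFormula M ⊥ᵖ       ρ = ⇔.refl
  Sat-toFormula M (atom a) ρ = ⇔.refl
  Sat-toFormula M (¬ᵖ φ)   ρ = ¬-cong-⇔ (Sat-toFormula M φ ρ)
  Sat-toFormula M (φ ∧ᵖ ψ) ρ = Sat-toFormula M φ ρ ×-⇔ Sat-toFormula M ψ ρ
  Sat-toFormula M (φ ∨ᵖ ψ) ρ = Sat-toFormula M φ ρ ⊎-⇔ Sat-toFormula M ψ ρ

module _ {R : Set} {ar : R → ℕ} where

  varOf : ∀ {n} → Term (relSig R ar) n → Fin n
  varOf (var i) = i

  evalT-varOf : ∀ (M : Structure (relSig R ar)) {n} (t : Term (relSig R ar) n) ρ →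
    evalT (relSig R ar) M t ρ ≡ ρ (varOf t)
  evalT-varOf M (var i) ρ = refl

module _ (A : Pred ℤ 0ℓ) {R₁ R₂ : Set} {ar₁ : R₁ → ℕ} {ar₂ : R₂ → ℕ}
         (I₁ : (r : R₁) → Vector ℤ (ar₁ r) → Set) (I₂ : (r : R₂) → Vector ℤ (ar₂ r) → Set) where

  private
    L₁ = relSig R₁ ar₁
    L₂ = relSig R₂ ar₂

  -- Stated for every a pointwise equal to the arguments, since I₁ r need not respect pointwise equality.
  RelationsDefinable : Set
  RelationsDefinable = (r : R₁) → ∀ {n} (vs : Fin (ar₁ r) → Fin n) →
    Σ[ ψ ∈ Formula L₂ n ] (∀ ρ a → (∀ j → proj₁ (ρ (vs j)) ≡ a j) → Sat L₂ (onA A I₂) ψ ρ ⇔ I₁ r a)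

  module _ (rels : RelationsDefinable) where

    translate : ∀ {n} → Formula L₁ n → Formula L₂ n
    translate falsum      = falsum
    translate (equal t u) = equal (var (varOf t)) (var (varOf u))
    translate (rel r ts)  = proj₁ (rels r (varOf ∘ ts))
    translate (neg φ)     = neg (translate φ)
    translate (conj φ ψ)  = conj (translate φ) (translate ψ)
    translate (disj φ ψ)  = disj (translate φ) (translate ψ)
    translate (impl φ ψ)  = impl (translate φ) (translate ψ)
    translate (exi φ)     = exi (translate φ)
    translate (all φ)     = all (translate φ)

    Sat-translate : ∀ {n} (φ : Formula L₁ n) ρ → Sat L₂ (onA A I₂) (translate φ) ρ ⇔ Sat L₁ (onA A I₁) φ ρ
    Sat-translate falsum      ρ = ⇔.refl
    Sat-translate (equal t u) ρ rewrite evalT-varOf (onA A I₁) t ρ | evalT-varOf (onA A I₁) u ρ = ⇔.refl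
    Sat-translate (rel r ts)  ρ =
      proj₂ (rels r (varOf ∘ ts)) ρ _ (λ j → cong proj₁ (sym (evalT-varOf (onA A I₁) (ts j) ρ)))
    Sat-translate (neg φ)     ρ = ¬-cong-⇔ (Sat-translate φ ρ)
    Sat-translate (conj φ ψ)  ρ = Sat-translate φ ρ ×-⇔ Sat-translate ψ ρ
    Sat-translate (disj φ ψ)  ρ = Sat-translate φ ρ ⊎-⇔ Sat-translate ψ ρ
    Sat-translate (impl φ ψ)  ρ = →-cong-⇔ (Sat-translate φ ρ) (Sat-translate ψ ρ)
    Sat-translate (exi φ)     ρ = ∃-⇔ (λ a → Sat-translate φ (a ∷ᵥ ρ))
    Sat-translate (all φ)     ρ = ∀-⇔ (λ a → Sat-translate φ (a ∷ᵥ ρ))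

    definable-transfer : ∀ k X → Definable L₁ (onA A I₁) k X → Definable L₂ (onA A I₂) k X
    definable-transfer k X (m , φ , b , X⇔φ) =
      m , translate φ , b , λ a → ⇔.trans (X⇔φ a) (⇔.sym (Sat-translate φ (a ++ᵥ b)))

sumℤ-cong : ∀ {k} {f g : Vector ℤ k} → (∀ i → f i ≡ g i) → sumℤ f ≡ sumℤ g
sumℤ-cong {zero}  f≗g = refl
sumℤ-cong {suc k} f≗g = cong₂ _+_ (f≗g zero) (sumℤ-cong (f≗g ∘ suc))

sumℤ-+ : ∀ {k} (f g : Vector ℤ k) → sumℤ (λ i → f i + g i) ≡ sumℤ f + sumℤ g
sumℤ-+ {zero}  f g = refl
sumℤ-+ {suc k} f g = begin
  f zero + g zero + sumℤ (λ i → f (suc i) + g (suc i))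
    ≡⟨ cong (_+_ (f zero + g zero)) (sumℤ-+ (tail f) (tail g)) ⟩
  f zero + g zero + (sumℤ (tail f) + sumℤ (tail g))
    ≡⟨ medial (f zero) (g zero) _ _ ⟩
  f zero + sumℤ (tail f) + (g zero + sumℤ (tail g)) ∎
  where
  open ≡-Reasoning
  medial : ∀ a b c d → a + b + (c + d) ≡ a + c + (b + d)
  medial = solve-∀

sumℤ-* : ∀ {k} u (f : Vector ℤ k) → sumℤ (λ i → u * f i) ≡ u * sumℤ f
sumℤ-* {zero}  u f = sym (ℤP.*-zeroʳ u)
sumℤ-* {suc k} u f =
  trans (cong (_+_ (u * f zero)) (sumℤ-* u (tail f))) (sym (ℤP.*-distribˡ-+ u (f zero) _))

sumℤ-split : ∀ k {m} (f : Vector ℤ (k ℕ.+ m)) →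
  sumℤ f ≡ sumℤ (λ i → f (i ↑ˡ m)) + sumℤ (λ j → f (k ↑ʳ j))
sumℤ-split zero    f = sym (ℤP.+-identityˡ _)
sumℤ-split (suc k) f =
  trans (cong (_+_ (f zero)) (sumℤ-split k (tail f))) (sym (ℤP.+-assoc (f zero) _ _))

dot : ∀ {k} → Vector ℤ k → Vector ℤ k → ℤ
dot c x = sumℤ (λ i → c i * x i)

dot-congʳ : ∀ {k} (c : Vector ℤ k) {x y : Vector ℤ k} → (∀ i → x i ≡ y i) → dot c x ≡ dot c y
dot-congʳ c x≗y = sumℤ-cong (λ i → cong (c i *_) (x≗y i))

dot-+ˡ : ∀ {k} (c d x : Vector ℤ k) → dot (λ i → c i + d i) x ≡ dot c x + dot d x
dot-+ˡ c d x =
  trans (sumℤ-cong (λ i → ℤP.*-distribʳ-+ (x i) (c i) (d i))) (sumℤ-+ (λ i → c i * x i) (λ i → d i * x i))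

dot-*ˡ : ∀ {k} u (c x : Vector ℤ k) → dot (λ i → u * c i) x ≡ u * dot c x
dot-*ˡ u c x = trans (sumℤ-cong (λ i → ℤP.*-assoc u (c i) (x i))) (sumℤ-* u (λ i → c i * x i))

dot--ˡ : ∀ {k} (c d x : Vector ℤ k) → dot (λ i → c i - d i) x ≡ dot c x - dot d x
dot--ˡ c d x = begin
  dot (λ i → c i - d i) x                        ≡⟨ sumℤ-cong (λ i → l₁ (c i) (d i) (x i)) ⟩
  sumℤ (λ i → c i * x i + -1ℤ * (d i * x i))     ≡⟨ sumℤ-+ (λ i → c i * x i) (λ i → -1ℤ * (d i * x i)) ⟩
  dot c x + sumℤ (λ i → -1ℤ * (d i * x i))       ≡⟨ cong (_+_ (dot c x)) (sumℤ-* -1ℤ (λ i → d i * x i)) ⟩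
  dot c x + -1ℤ * dot d x                        ≡⟨ l₂ (dot c x) (dot d x) ⟩
  dot c x - dot d x                              ∎
  where
  open ≡-Reasoning
  l₁ : ∀ c d x → (c - d) * x ≡ c * x + -1ℤ * (d * x)
  l₁ = solve-∀
  l₂ : ∀ a b → a + -1ℤ * b ≡ a - b
  l₂ = solve-∀

unitVector : ∀ {k} → Fin k → Vector ℤ k
unitVector zero    zero    = 1ℤ
unitVector zero    (suc j) = 0ℤ
unitVector (suc i) zero    = 0ℤ
unitVector (suc i) (suc j) = unitVector i j

dot-0ˡ : ∀ {k} (x : Vector ℤ k) → dot (λ _ → 0ℤ) x ≡ 0ℤ
dot-0ˡ {zero}  x = refl
dot-0ˡ {suc k} x = trans (ℤP.+-identityˡ _) (dot-0ˡ (tail x))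

dot-unitVector : ∀ {k} (i : Fin k) (x : Vector ℤ k) → dot (unitVector i) x ≡ x i
dot-unitVector zero    x =
  trans (cong (_+_ (1ℤ * x zero)) (dot-0ˡ (tail x))) (trans (ℤP.+-identityʳ _) (ℤP.*-identityˡ (x zero)))
dot-unitVector (suc i) x = trans (ℤP.+-identityˡ _) (dot-unitVector i (tail x))

dot-++ : ∀ k {m} (c : Vector ℤ (k ℕ.+ m)) (x : Vector ℤ k) (b : Vector ℤ m) →
  dot c (x ++ᵥ b) ≡ dot (λ i → c (i ↑ˡ m)) x + dot (λ j → c (k ↑ʳ j)) b
dot-++ k {m} c x b = trans (sumℤ-split k (λ i → c i * (x ++ᵥ b) i))
  (cong₂ _+_ (dot-congʳ (λ i → c (i ↑ˡ m)) (lookup-++ˡ x b)) (dot-congʳ (λ j → c (k ↑ʳ j)) (lookup-++ʳ x b)))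

module _ {A : Set} (f : A → ℤ) where

  listSum : List A → ℤ
  listSum []       = 0ℤ
  listSum (x ∷ xs) = f x + listSum xs

  listSum-lookup : ∀ xs → sumℤ (f ∘ List.lookup xs) ≡ listSum xs
  listSum-lookup []       = refl
  listSum-lookup (x ∷ xs) = cong (_+_ (f x)) (listSum-lookup xs)

  listSum-++ : ∀ xs ys → listSum (xs ++ ys) ≡ listSum xs + listSum ys
  listSum-++ []       ys = sym (ℤP.+-identityˡ _)
  listSum-++ (x ∷ xs) ys = trans (cong (_+_ (f x)) (listSum-++ xs ys)) (sym (ℤP.+-assoc (f x) _ _))

  listSum-replicate : ∀ k x → listSum (replicate k x) ≡ + k * f x
  listSum-replicate zero    x = sym (ℤP.*-zeroˡ (f x))
  listSum-replicate (suc k) x = trans (cong (_+_ (f x)) (listSum-replicate k x)) (l (f x) (+ k))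
    where
    l : ∀ a k → a + k * a ≡ (1ℤ + k) * a
    l = solve-∀

splits : ∀ {A : Set} → List A → List (List A × List A)
splits []       = ([] , []) ∷ []
splits (x ∷ xs) = List.map (Product.map₁ (x ∷_)) (splits xs) ++ List.map (Product.map₂ (x ∷_)) (splits xs)

splits-listSum : ∀ {A : Set} (f : A → ℤ) xs →
  All (λ (ys , zs) → listSum f ys + listSum f zs ≡ listSum f xs) (splits xs)
splits-listSum f []       = refl ∷ []
splits-listSum f (x ∷ xs) =
  ++⁺ (map⁺ (All.map (λ e → trans (ℤP.+-assoc (f x) _ _) (cong (_+_ (f x)) e)) (splits-listSum f xs)))
      (map⁺ (All.map (λ {(ys , zs)} e → trans (swap (f x) (listSum f ys) (listSum f zs)) (cong (_+_ (f x)) e))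
                     (splits-listSum f xs)))
  where
  swap : ∀ a b c → b + (a + c) ≡ a + (b + c)
  swap = solve-∀

module _ {A : Set} where

  pick unpick : (xs : List A) → (Fin (length xs) → Bool) → List A
  pick   []       I = []
  pick   (x ∷ xs) I = if I zero then x ∷ pick xs (tail I) else pick xs (tail I)
  unpick []       I = []
  unpick (x ∷ xs) I = if I zero then unpick xs (tail I) else x ∷ unpick xs (tail I)

  pick-unpick∈splits : ∀ xs I → (pick xs I , unpick xs I) ∈ splits xs
  pick-unpick∈splits []       I = here refl
  pick-unpick∈splits (x ∷ xs) I with I zero
  ... | true  = ∈-++⁺ˡ (∈-map⁺ (Product.map₁ (x ∷_)) (pick-unpick∈splits xs (tail I)))
  ... | false = ∈-++⁺ʳ _ (∈-map⁺ (Product.map₂ (x ∷_)) (pick-unpick∈splits xs (tail I)))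

  sumOver-lookup : ∀ (f : A → ℤ) xs I → sumOver I (f ∘ List.lookup xs) ≡ listSum f (pick xs I)
  sumOver-lookup f []       I = refl
  sumOver-lookup f (x ∷ xs) I with I zero
  ... | true  = cong (_+_ (f x)) (sumOver-lookup f xs (tail I))
  ... | false = trans (ℤP.+-identityˡ _) (sumOver-lookup f xs (tail I))

  length-pick-unpick : ∀ xs I → length (pick xs I) ℕ.+ length (unpick xs I) ≡ length xs
  length-pick-unpick []       I = refl
  length-pick-unpick (x ∷ xs) I with I zero
  ... | true  = cong suc (length-pick-unpick xs (tail I))
  ... | false = trans (ℕP.+-suc _ _) (cong suc (length-pick-unpick xs (tail I)))

  pick-nonempty : ∀ xs I → ∃[ i ] I i ≡ true → 1 ℕ.≤ length (pick xs I)
  pick-nonempty (x ∷ xs) I (zero , Iᵢ≡true) rewrite Iᵢ≡true = ℕ.s≤s ℕ.z≤n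
  pick-nonempty (x ∷ xs) I (suc i , Iᵢ≡true) with I zero
  ... | true  = ℕ.s≤s ℕ.z≤n
  ... | false = pick-nonempty xs (tail I) (i , Iᵢ≡true)

  unpick-nonempty : ∀ xs I → ∃[ i ] I i ≡ false → 1 ℕ.≤ length (unpick xs I)
  unpick-nonempty (x ∷ xs) I (zero , Iᵢ≡false) rewrite Iᵢ≡false = ℕ.s≤s ℕ.z≤n
  unpick-nonempty (x ∷ xs) I (suc i , Iᵢ≡false) with I zero
  ... | true  = unpick-nonempty xs (tail I) (i , Iᵢ≡false)
  ... | false = ℕ.s≤s ℕ.z≤n

≡⇔≡-byDifference : ∀ {a b c d} → a - b ≡ c - d → (a ≡ b ⇔ c ≡ d)
≡⇔≡-byDifference {a} {b} {c} {d} e = mk⇔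
  (λ a≡b → i-j≡0⇒i≡j c d (trans (sym e) (i≡j⇒i-j≡0 a≡b)))
  (λ c≡d → i-j≡0⇒i≡j a b (trans e (i≡j⇒i-j≡0 c≡d)))

infix 4 _≡_[mod_]
record _≡_[mod_] (a b m : ℤ) : Set where
  constructor _,_
  field
    quotient : ℤ
    equation : a ≡ b + m * quotient

mod-congˡ : ∀ {a a′ r m} → a ≡ a′ → a ≡ r [mod m ] ⇔ a′ ≡ r [mod m ]
mod-congˡ refl = ⇔.refl

mod-0 : ∀ {a b} → a ≡ b [mod 0ℤ ] ⇔ a ≡ b
mod-0 {a} {b} = mk⇔ (λ (q , e) → trans e (ℤP.+-identityʳ b)) (λ e → 0ℤ , trans e (sym (ℤP.+-identityʳ b)))

mod-shift : ∀ {a a′ k r m} → a ≡ a′ + k → a ≡ r [mod m ] ⇔ a′ ≡ r - k [mod m ]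
mod-shift {a} {a′} {k} {r} {m} a≡a′+k = mk⇔
  (λ (q , e) → q , (begin
    a′                ≡⟨ l₁ a′ k ⟩
    a′ + k - k        ≡⟨ cong (_- k) (trans (sym a≡a′+k) e) ⟩
    r + m * q - k     ≡⟨ l₂ r (m * q) k ⟩
    r - k + m * q     ∎))
  (λ (q , e) → q , (begin
    a                 ≡⟨ a≡a′+k ⟩
    a′ + k            ≡⟨ cong (_+ k) e ⟩
    r - k + m * q + k ≡⟨ l₃ r (m * q) k ⟩
    r + m * q         ∎))
  where
  open ≡-Reasoning
  l₁ : ∀ a k → a ≡ a + k - k
  l₁ = solve-∀
  l₂ : ∀ r s k → r + s - k ≡ r - k + s
  l₂ = solve-∀
  l₃ : ∀ r s k → r - k + s + k ≡ r + s
  l₃ = solve-∀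

mod-scale : ∀ u {a r m} .{{_ : NonZero u}} → u * a ≡ u * r [mod u * m ] ⇔ a ≡ r [mod m ]
mod-scale u {a} {r} {m} = mk⇔
  (λ (q , e) → q , ℤP.*-cancelˡ-≡ u a (r + m * q) (trans e (l u r m q)))
  (λ (q , e) → q , trans (cong (u *_) e) (sym (l u r m q)))
  where
  l : ∀ u r m q → u * r + u * m * q ≡ u * (r + m * q)
  l = solve-∀

mod-periodic : ∀ {a r m} d → a + m * d ≡ r [mod m ] ⇔ a ≡ r [mod m ]
mod-periodic {a} {r} {m} d = mk⇔
  (λ (q , e) → q - d , trans (l₁ a (m * d)) (trans (cong (_- m * d) e) (l₂ r m q d)))
  (λ (q , e) → q + d , trans (cong (_+ m * d) e) (l₃ r m q d))
  where
  l₁ : ∀ a s → a ≡ a + s - s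
  l₁ = solve-∀
  l₂ : ∀ r m q d → r + m * q - m * d ≡ r + m * (q - d)
  l₂ = solve-∀
  l₃ : ∀ r m q d → r + m * q + m * d ≡ r + m * (q + d)
  l₃ = solve-∀

mod-neg : ∀ {a r m} → a ≡ r [mod - m ] ⇔ a ≡ r [mod m ]
mod-neg {a} {r} {m} = mk⇔
  (λ (q , e) → - q , trans e (cong (_+_ r) (l m q)))
  (λ (q , e) → - q , trans e (cong (_+_ r) (sym (l′ m q))))
  where
  l : ∀ m q → (- m) * q ≡ m * (- q)
  l = solve-∀
  l′ : ∀ m q → (- m) * (- q) ≡ m * q
  l′ = solve-∀

mod-byResidue : ∀ k c x D r →
  (c * x + D ≡ r [mod + suc k ]) ⇔ (∃[ ρ ] InCongClass (k , ρ) x × D ≡ r - c * + toℕ ρ [mod + suc k ])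
mod-byResidue k c x D r = mk⇔
  (λ (q , e) → residue , (x / M , x≡) , (q - c * (x / M) , (begin
    D                                      ≡⟨ l₁ c x D ⟩
    c * x + D - c * x                      ≡⟨ cong₂ (λ u v → u - c * v) e x≡ ⟩
    r + M * q - c * (M * (x / M) + ρ)      ≡⟨ l₂ r M q c (x / M) ρ ⟩
    r - c * ρ + M * (q - c * (x / M))      ∎)))
  (λ (residue′ , (q₀ , x≡′) , (q₁ , D≡)) → c * q₀ + q₁ , (begin
    c * x + D                                                   ≡⟨ cong₂ (λ u v → c * u + v) x≡′ D≡ ⟩
    c * (M * q₀ + + toℕ residue′) + (r - c * + toℕ residue′ + M * q₁) ≡⟨ l₃ c M q₀ (+ toℕ residue′) r q₁ ⟩
    r + M * (c * q₀ + q₁)                                       ∎))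
  where
  open ≡-Reasoning
  M = + suc k
  residue = fromℕ< (n%d<d x M)
  ρ = + toℕ residue
  x≡ : x ≡ M * (x / M) + ρ
  x≡ = trans (a≡a%n+[a/n]*n x M) (trans (ℤP.+-comm (+ (x % M)) (x / M * M))
         (cong₂ (λ u v → u + + v) (ℤP.*-comm (x / M) M) (sym (FinP.toℕ-fromℕ< _))))
  l₁ : ∀ c x D → D ≡ c * x + D - c * x
  l₁ = solve-∀
  l₂ : ∀ r M q c d ρ → r + M * q - c * (M * d + ρ) ≡ r - c * ρ + M * (q - c * d)
  l₂ = solve-∀
  l₃ : ∀ c M q₀ ρ r q₁ → c * (M * q₀ + ρ) + (r - c * ρ + M * q₁) ≡ r + M * (c * q₀ + q₁)
  l₃ = solve-∀

-- Quantifier elimination for (ℤ, +)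

-- lincong m c r is the congruence c·x ≡ r (mod m); for m = 0 it is the equation c·x = r.
record LinCong (n : ℕ) : Set where
  constructor lincong
  field
    modulus : ℤ
    coeffs  : Vector ℤ n
    rhs     : ℤ
open LinCong

_holdsAt_ : ∀ {n} → LinCong n → Vector ℤ n → Set
lincong m c r holdsAt x = dot c x ≡ r [mod m ]

QF : ℕ → Set
QF n = Prop (LinCong n)

⟦_⟧ℤ : ∀ {n} → QF n → Vector ℤ n → Set
⟦ φ ⟧ℤ x = ⟦ φ ⟧ (_holdsAt x)

holdsAt-cong : ∀ {n} (a : LinCong n) {x y : Vector ℤ n} → (∀ i → x i ≡ y i) → a holdsAt x ⇔ a holdsAt y
holdsAt-cong (lincong m c r) x≗y = mod-congˡ (dot-congʳ c x≗y)

⟦⟧ℤ-cong : ∀ {n} (φ : QF n) {x y : Vector ℤ n} → (∀ i → x i ≡ y i) → ⟦ φ ⟧ℤ x ⇔ ⟦ φ ⟧ℤ y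
⟦⟧ℤ-cong φ x≗y = ⟦⟧-cong′ φ (λ a → holdsAt-cong a x≗y)

-- Quantifiers are eliminated in the first variable, called y.
IsYEquation : ∀ {n} → LinCong (suc n) → Set
IsYEquation a = modulus a ≡ 0ℤ × coeffs a zero ≢ 0ℤ

isYEquation? : ∀ {n} (a : LinCong (suc n)) → Dec (IsYEquation a)
isYEquation? a = (modulus a ℤ.≟ 0ℤ) ×-dec ¬? (coeffs a zero ℤ.≟ 0ℤ)

instantiate : ∀ {n} → ℤ → LinCong (suc n) → LinCong n
instantiate y (lincong m c r) = lincong m (tail c) (r - c zero * y)

instantiate-holds : ∀ {n} y (a : LinCong (suc n)) x → instantiate y a holdsAt x ⇔ a holdsAt (y ∷ᵥ x)
instantiate-holds y (lincong m c r) x =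
  ⇔.sym (mod-shift {r = r} {m = m} (ℤP.+-comm (c zero * y) (dot (tail c) x)))

fixParams : ∀ {k m} → Vector ℤ m → LinCong (k ℕ.+ m) → LinCong k
fixParams {k} {m} b (lincong μ c r) = lincong μ (λ i → c (i ↑ˡ m)) (r - dot (λ j → c (k ↑ʳ j)) b)

fixParams-holds : ∀ {k m} (b : Vector ℤ m) a (x : Vector ℤ k) → fixParams b a holdsAt x ⇔ a holdsAt (x ++ᵥ b)
fixParams-holds {k} b (lincong μ c r) x = ⇔.sym (mod-shift {r = r} {m = μ} (dot-++ k c x b))

solvability : ∀ {n} → LinCong (suc n) → LinCong n
solvability (lincong _ c r) = lincong (c zero) (tail c) r

solvability-holds : ∀ {n} (e : LinCong (suc n)) {x} → modulus e ≡ 0ℤ →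
  solvability e holdsAt x ⇔ (∃[ y ] e holdsAt (y ∷ᵥ x))
solvability-holds (lincong _ c r) {x} refl = mk⇔
  (λ (q , e) → - q , from (mod-0 {c zero * - q + dot (tail c) x}) (begin
    c zero * - q + dot (tail c) x    ≡⟨ cong (_+_ (c zero * - q)) e ⟩
    c zero * - q + (r + c zero * q)  ≡⟨ l (c zero) q r ⟩
    r                                ∎))
  (λ (y , e) → - y , (begin
    dot (tail c) x                              ≡⟨ l′ (c zero) y (dot (tail c) x) ⟩
    c zero * y + dot (tail c) x + c zero * - y  ≡⟨ cong (_+ c zero * - y) (to (mod-0 {_} {r}) e) ⟩
    r + c zero * - y                            ∎))
  where
  open ≡-Reasoning
  l : ∀ c q r → c * - q + (r + c * q) ≡ r
  l = solve-∀
  l′ : ∀ c y d → d ≡ c * y + d + c * - y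
  l′ = solve-∀

-- Substituting y := (r - c′·x) / c₀ from the equation c₀ y + c′·x = r, after scaling by c₀.
substitute : ∀ {n} → LinCong (suc n) → LinCong (suc n) → LinCong n
substitute (lincong _ c r) (lincong m d s) =
  lincong (c zero * m) (λ i → c zero * d (suc i) + (- d zero) * c (suc i)) (c zero * s - d zero * r)

substitute-holds : ∀ {n} (e : LinCong (suc n)) {y x} → IsYEquation e → e holdsAt (y ∷ᵥ x) →
  ∀ a → substitute e a holdsAt x ⇔ a holdsAt (y ∷ᵥ x)
substitute-holds (lincong _ c r) {y} {x} (refl , c₀≢0) e-holds (lincong m d s) =
  ⇔.trans (⇔.sym (mod-shift {r = c zero * s} {m = c zero * m} scaled))
          (mod-scale (c zero) {{ℤ.≢-nonZero c₀≢0}})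
  where
  open ≡-Reasoning
  D = dot (tail d) x
  C = dot (tail c) x
  l : ∀ c₀ d₀ y D C → c₀ * (d₀ * y + D) ≡ c₀ * D + (- d₀) * C + d₀ * (c₀ * y + C)
  l = solve-∀
  scaled : c zero * (d zero * y + D) ≡ dot (λ i → c zero * d (suc i) + (- d zero) * c (suc i)) x + d zero * r
  scaled = begin
    c zero * (d zero * y + D)                                ≡⟨ l (c zero) (d zero) y D C ⟩
    c zero * D + (- d zero) * C + d zero * (c zero * y + C)  ≡⟨ cong₂ (λ u v → u + d zero * v) combined
                                                                  (to (mod-0 {dot c (y ∷ᵥ x)} {r}) e-holds) ⟩
    dot (λ i → c zero * d (suc i) + (- d zero) * c (suc i)) x + d zero * r ∎
    where
    combined : c zero * D + (- d zero) * C ≡ dot (λ i → c zero * d (suc i) + (- d zero) * c (suc i)) x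
    combined = sym (trans (dot-+ˡ (λ i → c zero * d (suc i)) (λ i → - d zero * c (suc i)) x)
                          (cong₂ _+_ (dot-*ˡ (c zero) (tail d) x) (dot-*ˡ (- d zero) (tail c) x)))

dropY : ∀ {n} → LinCong (suc n) → QF (suc n)
dropY a with isYEquation? a
... | yes _ = ⊥ᵖ
... | no _  = atom a

dropY-holds : ∀ {n} (a : LinCong (suc n)) {v} → ¬ (IsYEquation a × a holdsAt v) →
  ⟦ dropY a ⟧ (_holdsAt v) ⇔ a holdsAt v
dropY-holds a ¬solved with isYEquation? a
... | yes isEq = mk⇔ (λ ()) (λ holds → ¬solved (isEq , holds))
... | no _     = ⇔.refl

orOne : ∀ m → Dec (m ≡ 0ℤ) → ℤ
orOne m (yes _) = 1ℤ
orOne m (no _)  = m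

nonzeroModulus : ∀ {n} → LinCong n → ℤ
nonzeroModulus a = orOne (modulus a) (modulus a ℤ.≟ 0ℤ)

period : ∀ {n} → List (LinCong n) → ℤ
period []       = 1ℤ
period (a ∷ as) = nonzeroModulus a * period as

period-nonZero : ∀ {n} (as : List (LinCong n)) → NonZero (period as)
period-nonZero []       = _
period-nonZero (a ∷ as) =
  ℤP.i*j≢0 (nonzeroModulus a) (period as) {{nonzeroModulus-nonZero}} {{period-nonZero as}}
  where
  nonzeroModulus-nonZero : NonZero (nonzeroModulus a)
  nonzeroModulus-nonZero with modulus a ℤ.≟ 0ℤ
  ... | yes _  = _
  ... | no m≢0 = ℤ.≢-nonZero m≢0

period-multiple : ∀ {n} (as : List (LinCong n)) →
  All (λ a → modulus a ≢ 0ℤ → ∃[ k ] period as ≡ modulus a * k) as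
period-multiple []       = []
period-multiple {n} (a ∷ as) = head ∷ All.map (λ {b} → extend {b}) (period-multiple as)
  where
  head : modulus a ≢ 0ℤ → ∃[ k ] period (a ∷ as) ≡ modulus a * k
  head m≢0 with modulus a ℤ.≟ 0ℤ
  ... | yes m≡0 = ⊥-elim (m≢0 m≡0)
  ... | no _    = period as , refl
  extend : ∀ {b : LinCong n} → (modulus b ≢ 0ℤ → ∃[ k ] period as ≡ modulus b * k) →
                    (modulus b ≢ 0ℤ → ∃[ k ] period (a ∷ as) ≡ modulus b * k)
  extend {b} divides m≢0 with divides m≢0
  ... | k , e =
    nonzeroModulus a * k , trans (cong (nonzeroModulus a *_) e) (l (nonzeroModulus a) (modulus b) k)
    where
    l : ∀ u m k → u * (m * k) ≡ m * (u * k)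
    l = solve-∀

holdsAt-periodic : ∀ {n} (a : LinCong (suc n)) {p} → ¬ IsYEquation a →
  (modulus a ≢ 0ℤ → ∃[ k ] p ≡ modulus a * k) →
  ∀ y d x → a holdsAt (y + p * d ∷ᵥ x) ⇔ a holdsAt (y ∷ᵥ x)
holdsAt-periodic (lincong m c r) notEq p-multiple y d x with m ℤ.≟ 0ℤ | c zero ℤ.≟ 0ℤ
... | yes refl | no c₀≢0  = ⊥-elim (notEq (refl , c₀≢0))
... | yes refl | yes c₀≡0 =
  mod-congˡ (cong (_+ dot (tail c) x) (trans (annihilates c₀≡0) (sym (annihilates c₀≡0))))
  where
  annihilates : ∀ {u z} → u ≡ 0ℤ → u * z ≡ 0ℤ
  annihilates {z = z} refl = ℤP.*-zeroˡ z
... | no m≢0 | _ with p-multiple m≢0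
...   | k , refl = ⇔.trans (mod-congˡ (l (c zero) y m k d (dot (tail c) x))) (mod-periodic (c zero * (k * d)))
  where
  l : ∀ c₀ y m k d D → c₀ * (y + m * k * d) + D ≡ c₀ * y + D + m * (c₀ * (k * d))
  l = solve-∀

dropY-periodic : ∀ {n} (a : LinCong (suc n)) {p} → (modulus a ≢ 0ℤ → ∃[ k ] p ≡ modulus a * k) →
  ∀ y d x → ⟦ dropY a ⟧ (_holdsAt (y + p * d ∷ᵥ x)) ⇔ ⟦ dropY a ⟧ (_holdsAt (y ∷ᵥ x))
dropY-periodic a p-multiple y d x with isYEquation? a
... | yes _    = ⇔.refl
... | no notEq = holdsAt-periodic a notEq p-multiple y d x

gap : ∀ {n} → ℤ → Vector ℤ n → LinCong (suc n) → ℕ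
gap y x (lincong _ c r) = ∣ r - dot (tail c) x - c zero * y ∣

gapBound : ∀ {n} → ℤ → Vector ℤ n → List (LinCong (suc n)) → ℕ
gapBound y x as = sum (List.map (gap y x) as)

gap≤gapBound : ∀ {n} y (x : Vector ℤ n) as → All (λ a → gap y x a ℕ.≤ gapBound y x as) as
gap≤gapBound y x []       = []
gap≤gapBound y x (a ∷ as) =
  ℕP.m≤m+n (gap y x a) _ ∷ All.map (λ g≤b → ℕP.≤-trans g≤b (ℕP.m≤n+m _ (gap y x a))) (gap≤gapBound y x as)

≤∣*∣ : ∀ u K .{{_ : NonZero u}} → K ℕ.≤ ∣ u * + K ∣
≤∣*∣ u K = ℕP.≤-trans (ℕP.m≤n*m K ∣ u ∣) (ℕP.≤-reflexive (sym (ℤP.abs-* u (+ K))))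

-- A solution would give ∣ c₀ p ∣ K = gap y x e < K.
escapes : ∀ {n} (e : LinCong (suc n)) p .{{_ : NonZero p}} y x K → IsYEquation e → gap y x e ℕ.< K →
  ¬ e holdsAt (y + p * + K ∷ᵥ x)
escapes (lincong _ c r) p y x K (refl , c₀≢0) gap<K holds =
  ℕP.<-irrefl refl (ℕP.<-≤-trans gap<K
    (ℕP.≤-trans (≤∣*∣ (c zero * p) K {{nonZero}}) (ℕP.≤-reflexive (cong ∣_∣ solved))))
  where
  instance
    nonZero : NonZero (c zero * p)
    nonZero = ℤP.i*j≢0 (c zero) p {{ℤ.≢-nonZero c₀≢0}}
  l : ∀ c₀ y p K C → c₀ * p * K ≡ c₀ * (y + p * K) + C - C - c₀ * y
  l = solve-∀
  solved : c zero * p * + K ≡ r - dot (tail c) x - c zero * y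
  solved = trans (l (c zero) y p (+ K) (dot (tail c) x))
                 (cong (λ v → v - dot (tail c) x - c zero * y) (to (mod-0 {_} {r}) holds))

instantiate-all : ∀ {n} (φ : QF (suc n)) y x → ⟦ φ >>= (atom ∘ instantiate y) ⟧ℤ x ⇔ ⟦ φ ⟧ℤ (y ∷ᵥ x)
instantiate-all φ y x = ⇔.trans (⟦>>=⟧ φ _) (⟦⟧-cong′ φ (λ a → instantiate-holds y a x))

module _ {n : ℕ} (φ : QF (suc n)) where

  substitute-all : ∀ e {y x} → IsYEquation e → e holdsAt (y ∷ᵥ x) →
    ⟦ φ >>= (atom ∘ substitute e) ⟧ℤ x ⇔ ⟦ φ ⟧ℤ (y ∷ᵥ x)
  substitute-all e isEq holds = ⇔.trans (⟦>>=⟧ φ _) (⟦⟧-cong′ φ (substitute-holds e isEq holds))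

  dropY-all : ∀ {v} → All (λ a → ¬ (IsYEquation a × a holdsAt v)) (atoms φ) → ⟦ φ >>= dropY ⟧ℤ v ⇔ ⟦ φ ⟧ℤ v
  dropY-all {v} unsolved = ⇔.trans (⟦>>=⟧ φ dropY) (⟦⟧-cong φ (All.map (λ {a} → dropY-holds a {v}) unsolved))

  p : ℤ
  p = period (atoms φ)

  instance
    p-nonZero : NonZero p
    p-nonZero = period-nonZero (atoms φ)

  dropY-all-periodic : ∀ y d x → ⟦ φ >>= dropY ⟧ℤ (y + p * d ∷ᵥ x) ⇔ ⟦ φ >>= dropY ⟧ℤ (y ∷ᵥ x)
  dropY-all-periodic y d x = ⇔.trans (⟦>>=⟧ φ dropY)
    (⇔.trans (⟦⟧-cong φ (All.map (λ {a} multiple → dropY-periodic a multiple y d x)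
                                 (period-multiple (atoms φ))))
             (⇔.sym (⟦>>=⟧ φ dropY)))

  solveWith : (e : LinCong (suc n)) → Dec (IsYEquation e) → QF n
  solveWith e (yes _) = atom (solvability e) ∧ᵖ (φ >>= (atom ∘ substitute e))
  solveWith e (no _)  = ⊥ᵖ

  solveWith-sound : ∀ e e? x → ⟦ solveWith e e? ⟧ℤ x → ∃[ y ] ⟦ φ ⟧ℤ (y ∷ᵥ x)
  solveWith-sound e (yes isEq) x (solvable , substituted) with to (solvability-holds e (proj₁ isEq)) solvable
  ... | y , holds = y , to (substitute-all e isEq holds) substituted

  solveWith-complete : ∀ e {y x} → IsYEquation e → e holdsAt (y ∷ᵥ x) → ⟦ φ ⟧ℤ (y ∷ᵥ x) →
    ⟦ solveWith e (isYEquation? e) ⟧ℤ x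
  solveWith-complete e {y} isEq holds φ-holds with isYEquation? e
  ... | yes _    =
    from (solvability-holds e (proj₁ isEq)) (y , holds) , from (substitute-all e isEq holds) φ-holds
  ... | no ¬isEq = ¬isEq isEq

  residueCase : ℤ → QF n
  residueCase i = (φ >>= dropY) >>= (atom ∘ instantiate i)

  elim : QF n
  elim = ⋁ (atoms φ) (λ e → solveWith e (isYEquation? e)) ∨ᵖ ⋁ (allFin ∣ p ∣) (λ i → residueCase (+ toℕ i))

  elim-sound : ∀ x → ⟦ elim ⟧ℤ x → ∃[ y ] ⟦ φ ⟧ℤ (y ∷ᵥ x)
  elim-sound x (inj₁ byEquation) with Any.satisfied (to (⟦⋁⟧ (atoms φ) _) byEquation)
  ... | e , solved = solveWith-sound e (isYEquation? e) x solved
  elim-sound x (inj₂ byResidue) with to (⟦⋁allFin⟧ ∣ p ∣ _) byResidue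
  ... | i , residue = y , to (dropY-all {y ∷ᵥ x} unsolved) (from (dropY-all-periodic (+ toℕ i) (+ K) x)
                                                            (to (instantiate-all (φ >>= dropY) _ x) residue))
    where
    K = suc (gapBound (+ toℕ i) x (atoms φ))
    y = + toℕ i + p * + K
    unsolved : All (λ a → ¬ (IsYEquation a × a holdsAt (y ∷ᵥ x))) (atoms φ)
    unsolved = All.map (λ {a} g≤b (isEq , holds) → escapes a p (+ toℕ i) x K isEq (ℕ.s≤s g≤b) holds)
                       (gap≤gapBound (+ toℕ i) x (atoms φ))

  elim-complete : ExcludedMiddle 0ℓ → ∀ x → ∃[ y ] ⟦ φ ⟧ℤ (y ∷ᵥ x) → ⟦ elim ⟧ℤ x
  elim-complete em x (y , φ-holds) with em {Any (λ e → IsYEquation e × e holdsAt (y ∷ᵥ x)) (atoms φ)}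
  ... | yes solved  = inj₁ (from (⟦⋁⟧ (atoms φ) _)
                             (Any.map (λ {e} (isEq , holds) → solveWith-complete e isEq holds φ-holds) solved))
  ... | no unsolved =
    inj₂ (from (⟦⋁allFin⟧ ∣ p ∣ _) (residue , from (instantiate-all (φ >>= dropY) _ x) reduced))
    where
    residue = fromℕ< (n%d<d y p)
    y-reduces : y + p * - (y / p) ≡ + toℕ residue
    y-reduces = begin
      y + p * - (y / p)                          ≡⟨ cong (λ v → v + p * - (y / p)) (a≡a%n+[a/n]*n y p) ⟩
      + (y % p) + y / p * p + p * - (y / p)      ≡⟨ l (+ (y % p)) (y / p) p ⟩
      + (y % p)                                  ≡⟨ cong +_ (sym (FinP.toℕ-fromℕ< (n%d<d y p))) ⟩
      + toℕ residue                              ∎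
      where
      open ≡-Reasoning
      l : ∀ r q p → r + q * p + p * - q ≡ r
      l = solve-∀
    reduced : ⟦ φ >>= dropY ⟧ℤ (+ toℕ residue ∷ᵥ x)
    reduced = subst (λ r → ⟦ φ >>= dropY ⟧ℤ (r ∷ᵥ x)) y-reduces
                (from (dropY-all-periodic y (- (y / p)) x)
                      (from (dropY-all {y ∷ᵥ x} (¬Any⇒All¬ _ unsolved)) φ-holds))

elim-correct : ExcludedMiddle 0ℓ → ∀ {n} (φ : QF (suc n)) x → ⟦ elim φ ⟧ℤ x ⇔ (∃[ y ] ⟦ φ ⟧ℤ (y ∷ᵥ x))
elim-correct em φ x = mk⇔ (elim-sound φ x) (elim-complete φ em x)

linearTerm : ∀ {n} → Term ZSig n → Vector ℤ n
linearTerm (var i)       = unitVector i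
linearTerm (app plus ts) = λ j → linearTerm (ts zero) j + linearTerm (ts (suc zero)) j

evalT-linear : ∀ {n} (t : Term ZSig n) x → evalT ZSig 𝒵 t x ≡ dot (linearTerm t) x
evalT-linear (var i)       x = sym (dot-unitVector i x)
evalT-linear (app plus ts) x =
  trans (cong₂ _+_ (evalT-linear (ts zero) x) (evalT-linear (ts (suc zero)) x))
        (sym (dot-+ˡ (linearTerm (ts zero)) (linearTerm (ts (suc zero))) x))

qe : ∀ {n} → Formula ZSig n → QF n
qe falsum      = ⊥ᵖ
qe (equal t u) = atom (lincong 0ℤ (λ j → linearTerm t j - linearTerm u j) 0ℤ)
qe (rel () _)
qe (neg φ)     = ¬ᵖ qe φ
qe (conj φ ψ)  = qe φ ∧ᵖ qe ψ
qe (disj φ ψ)  = qe φ ∨ᵖ qe ψ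
qe (impl φ ψ)  = ¬ᵖ qe φ ∨ᵖ qe ψ
qe (exi φ)     = elim (qe φ)
qe (all φ)     = ¬ᵖ elim (¬ᵖ qe φ)

module _ (em : ExcludedMiddle 0ℓ) where

  qe-correct : ∀ {n} (φ : Formula ZSig n) x → ⟦ qe φ ⟧ℤ x ⇔ Sat ZSig 𝒵 φ x
  qe-correct falsum      x = ⇔.refl
  qe-correct (equal t u) x = ⇔.trans mod-0 (≡⇔≡-byDifference (begin
    dot (λ j → linearTerm t j - linearTerm u j) x - 0ℤ  ≡⟨ ℤP.+-identityʳ _ ⟩
    dot (λ j → linearTerm t j - linearTerm u j) x       ≡⟨ dot--ˡ (linearTerm t) (linearTerm u) x ⟩
    dot (linearTerm t) x - dot (linearTerm u) x         ≡⟨ cong₂ _-_ (evalT-linear t x) (evalT-linear u x) ⟨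
    evalT ZSig 𝒵 t x - evalT ZSig 𝒵 u x                 ∎))
    where open ≡-Reasoning
  qe-correct (rel () _)  x
  qe-correct (neg φ)     x = ¬-cong-⇔ (qe-correct φ x)
  qe-correct (conj φ ψ)  x = qe-correct φ x ×-⇔ qe-correct ψ x
  qe-correct (disj φ ψ)  x = qe-correct φ x ⊎-⇔ qe-correct ψ x
  qe-correct (impl φ ψ)  x =
    ⇔.trans (¬-cong-⇔ (qe-correct φ x) ⊎-⇔ qe-correct ψ x) (classical-→ (em {Sat ZSig 𝒵 φ x}))
    where
    classical-→ : ∀ {P Q : Set} → Dec P → (¬ P ⊎ Q) ⇔ (P → Q)
    classical-→ P? = mk⇔ (λ { (inj₁ ¬p) p → ⊥-elim (¬p p) ; (inj₂ q) _ → q })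
                         (λ p→q → case P? of λ { (yes p) → inj₂ (p→q p) ; (no ¬p) → inj₁ ¬p })
  qe-correct (exi φ)     x = ⇔.trans (elim-correct em (qe φ) x) (∃-⇔ (λ y → qe-correct φ (y ∷ᵥ x)))
  qe-correct (all φ)     x =
    ⇔.trans (¬-cong-⇔ (⇔.trans (elim-correct em (¬ᵖ qe φ) x) (∃-⇔ (λ y → ¬-cong-⇔ (qe-correct φ (y ∷ᵥ x))))))
            (mk⇔ (λ ¬∃¬ y → decidable-stable (em {Sat ZSig 𝒵 φ (y ∷ᵥ x)}) (λ ¬φ → ¬∃¬ (y , ¬φ)))
                 (λ ∀φ (y , ¬φ) → ¬φ (∀φ y)))

-- Relations of A^𝒵_0 are definable in A^𝒵

posPart negPart : ℤ → ℕ
posPart (+ n)    = n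
posPart -[1+ n ] = 0
negPart (+ n)    = 0
negPart -[1+ n ] = suc n

posPart-negPart : ∀ c → c ≡ + posPart c - + negPart c
posPart-negPart (+ n)    = sym (ℤP.+-identityʳ (+ n))
posPart-negPart -[1+ n ] = refl

module _ {K : ℕ} where

  infixl 6 _⊕_
  _⊕_ : Term ZSig K → Term ZSig K → Term ZSig K
  t ⊕ u = app plus (t ∷ᵥ u ∷ᵥ []ᵥ)

  addMul : ℕ → Term ZSig K → Term ZSig K → Term ZSig K
  addMul zero    t acc = acc
  addMul (suc k) t acc = addMul k t acc ⊕ t

  addLinear : ∀ {N} → Vector ℕ N → Vector (Term ZSig K) N → Term ZSig K → Term ZSig K
  addLinear {zero}  ks ts acc = acc
  addLinear {suc N} ks ts acc = addLinear (tail ks) (tail ts) (addMul (ks zero) (ts zero) acc)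

  module _ (ρ : Vector ℤ K) where

    private
      ⟦_⟧ᵗ : Term ZSig K → ℤ
      ⟦ t ⟧ᵗ = evalT ZSig 𝒵 t ρ

    eval-addMul : ∀ k t acc → ⟦ addMul k t acc ⟧ᵗ ≡ ⟦ acc ⟧ᵗ + + k * ⟦ t ⟧ᵗ
    eval-addMul zero    t acc = sym (ℤP.+-identityʳ _)
    eval-addMul (suc k) t acc = trans (cong (_+ ⟦ t ⟧ᵗ) (eval-addMul k t acc)) (l ⟦ acc ⟧ᵗ ⟦ t ⟧ᵗ (+ k))
      where
      l : ∀ a t k → a + k * t + t ≡ a + (1ℤ + k) * t
      l = solve-∀

    eval-addLinear : ∀ {N} ks (ts : Vector (Term ZSig K) N) acc →
      ⟦ addLinear ks ts acc ⟧ᵗ ≡ ⟦ acc ⟧ᵗ + sumℤ (λ i → + ks i * ⟦ ts i ⟧ᵗ)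
    eval-addLinear {zero}  ks ts acc = sym (ℤP.+-identityʳ _)
    eval-addLinear {suc N} ks ts acc = begin
      ⟦ addLinear (tail ks) (tail ts) (addMul (ks zero) (ts zero) acc) ⟧ᵗ
        ≡⟨ eval-addLinear (tail ks) (tail ts) _ ⟩
      ⟦ addMul (ks zero) (ts zero) acc ⟧ᵗ + S
        ≡⟨ cong (_+ S) (eval-addMul (ks zero) (ts zero) acc) ⟩
      ⟦ acc ⟧ᵗ + + ks zero * ⟦ ts zero ⟧ᵗ + S
        ≡⟨ ℤP.+-assoc ⟦ acc ⟧ᵗ _ S ⟩
      ⟦ acc ⟧ᵗ + sumℤ (λ i → + ks i * ⟦ ts i ⟧ᵗ) ∎
      where
      open ≡-Reasoning
      S = sumℤ (λ i → + ks (suc i) * ⟦ ts (suc i) ⟧ᵗ)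

-- 𝒵 has no constants: both sides are built on the variable `one`, which is interpreted as 1, and the
-- congruence c·x ≡ r (mod m) becomes ∃q. 1 + c⁺·x + r⁻ + m⁻q = 1 + c⁻·x + r⁺ + m⁺q.
linCongSide : ∀ {N K} → (ℤ → ℕ) → (ℤ → ℕ) → LinCong N → (Fin N → Fin K) → Fin K → Term ZSig (suc K)
linCongSide f g (lincong m c r) vs one =
  addMul (g m) (var zero) (addMul (g r) (var (suc one)) (addLinear (f ∘ c) (var ∘ suc ∘ vs) (var (suc one))))

linCongFormula : ∀ {N K} → LinCong N → (Fin N → Fin K) → Fin K → Formula ZSig K
linCongFormula a vs one =
  exi (equal (linCongSide posPart negPart a vs one) (linCongSide negPart posPart a vs one))

Sat-linCongFormula : ∀ {N K} (a : LinCong N) vs one (ρ : Vector ℤ K) → ρ one ≡ 1ℤ →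
  Sat ZSig 𝒵 (linCongFormula a vs one) ρ ⇔ a holdsAt (ρ ∘ vs)
Sat-linCongFormula a@(lincong m c r) vs one ρ ρ-one≡1 =
  mk⇔ (λ (q , e) → q , to (equation q) e) (λ (q , e) → q , from (equation q) e)
  where
  x = ρ ∘ vs
  P = sumℤ (λ i → + posPart (c i) * x i)
  Q = sumℤ (λ i → + negPart (c i) * x i)
  side-value : ∀ f g q → evalT ZSig 𝒵 (linCongSide f g a vs one) (q ∷ᵥ ρ)
               ≡ 1ℤ + sumℤ (λ i → + f (c i) * x i) + + g r * 1ℤ + + g m * q
  side-value f g q = trans (eval-addMul (q ∷ᵥ ρ) (g m) _ _)
    (cong (_+ + g m * q) (trans (eval-addMul (q ∷ᵥ ρ) (g r) _ _)
      (cong₂ (λ u v → u + + g r * v)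
             (trans (eval-addLinear (q ∷ᵥ ρ) (f ∘ c) _ _) (cong (_+ sumℤ (λ i → + f (c i) * x i)) ρ-one≡1))
             ρ-one≡1)))
  dot≡P-Q : dot c x ≡ P - Q
  dot≡P-Q = trans (sumℤ-cong (λ i → cong (_* x i) (posPart-negPart (c i))))
                  (dot--ˡ (λ i → + posPart (c i)) (λ i → + negPart (c i)) x)
  l : ∀ P Q r⁺ r⁻ m⁺ m⁻ q →
    (1ℤ + P + r⁻ * 1ℤ + m⁻ * q) - (1ℤ + Q + r⁺ * 1ℤ + m⁺ * q) ≡ (P - Q) - ((r⁺ - r⁻) + (m⁺ - m⁻) * q)
  l = solve-∀
  left right : Term ZSig (suc _)
  left  = linCongSide posPart negPart a vs one
  right = linCongSide negPart posPart a vs one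
  equation : ∀ q → Sat ZSig 𝒵 (equal left right) (q ∷ᵥ ρ) ⇔ (dot c x ≡ r + m * q)
  equation q = ≡⇔≡-byDifference (begin
    evalT ZSig 𝒵 left (q ∷ᵥ ρ) - evalT ZSig 𝒵 right (q ∷ᵥ ρ)
      ≡⟨ cong₂ _-_ (side-value posPart negPart q) (side-value negPart posPart q) ⟩
    (1ℤ + P + r⁻ * 1ℤ + m⁻ * q) - (1ℤ + Q + r⁺ * 1ℤ + m⁺ * q)
      ≡⟨ l P Q r⁺ r⁻ m⁺ m⁻ q ⟩
    (P - Q) - ((r⁺ - r⁻) + (m⁺ - m⁻) * q)
      ≡⟨ sym (cong₂ (λ u v → u - (v + _)) dot≡P-Q (posPart-negPart r)) ⟩
    dot c x - (r + (m⁺ - m⁻) * q)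
      ≡⟨ sym (cong (λ w → dot c x - (r + w * q)) (posPart-negPart m)) ⟩
    dot c x - (r + m * q) ∎)
    where
    open ≡-Reasoning
    r⁺ = + posPart r
    r⁻ = + negPart r
    m⁺ = + posPart m
    m⁻ = + negPart m

qfFormula : ∀ {N K} → QF N → (Fin N → Fin K) → Fin K → Formula ZSig K
qfFormula φ vs one = toFormula (λ a → linCongFormula a vs one) φ

Sat-qfFormula : ∀ {N K} (φ : QF N) vs one (ρ : Vector ℤ K) → ρ one ≡ 1ℤ →
  Sat ZSig 𝒵 (qfFormula φ vs one) ρ ⇔ ⟦ φ ⟧ℤ (ρ ∘ vs)
Sat-qfFormula φ vs one ρ ρ-one≡1 =
  ⇔.trans (Sat-toFormula _ 𝒵 φ ρ) (⟦⟧-cong′ φ (λ a → Sat-linCongFormula a vs one ρ ρ-one≡1))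

qfSymbol : ∀ {n} → QF (suc n) → IndSym
qfSymbol {n} ψ = n , 1 , qfFormula ψ (_↑ˡ 1) (suc n ↑ʳ zero) , (λ _ → 1ℤ)

indI-qfSymbol : ∀ {n} (ψ : QF (suc n)) a → indI (qfSymbol ψ) a ⇔ ⟦ ψ ⟧ℤ a
indI-qfSymbol {n} ψ a = ⇔.trans (Sat-qfFormula ψ (_↑ˡ 1) (suc n ↑ʳ zero) (a ++ᵥ one) (lookup-++ʳ a one zero))
                                (⟦⟧ℤ-cong ψ (lookup-++ˡ a one))
  where
  one : Vector ℤ 1
  one _ = 1ℤ

Proper : ∀ {k} → (Fin k → Bool) → Set
Proper I = (∃[ i ] I i ≡ true) × (∃[ i ] I i ≡ false)

if-*ˡ : ∀ b u v → (if b then u else 0ℤ) * v ≡ (if b then u * v else 0ℤ)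
if-*ˡ true  u v = refl
if-*ˡ false u v = refl

module _ (em : ExcludedMiddle 0ℓ) where

  noZeroPartQF : ∀ {k} → Vector Sign k → (Fin k → Bool) → QF k
  noZeroPartQF c I =
    ¬ᵖ (decide (em {Proper I}) ∧ᵖ atom (lincong 0ℤ (λ i → if I i then signℤ (c i) else 0ℤ) 0ℤ))

  definingQF : (s : Sym0C) → QF (ar0C s)
  definingQF (inj₁ (k , r , c)) = atom (lincong 0ℤ (signℤ ∘ c) r) ∧ᵖ ⋀subset (suc k) (noZeroPartQF c)
  definingQF (inj₂ (n , ρ)) = atom (lincong (+ suc n) (unitVector zero) (+ toℕ ρ))

  definingQF-correct : ∀ s a → ⟦ definingQF s ⟧ℤ a ⇔ I0C s a
  definingQF-correct (inj₁ (k , r , c)) a =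
    mod-0 ×-⇔ ⟦⋀subset⟧ (suc k) (noZeroPartQF c) NoZeroPart respects noZeroPart
    where
    z = λ i → signℤ (c i) * a i
    NoZeroPart : (Fin (suc k) → Bool) → Set
    NoZeroPart I = (∃[ i ] I i ≡ true) → (∃[ i ] I i ≡ false) → ¬ sumOver I z ≡ 0ℤ
    sumOver-cong : ∀ {I J} → (∀ i → I i ≡ J i) → sumOver I z ≡ sumOver J z
    sumOver-cong I≗J = sumℤ-cong (λ i → cong (λ b → if b then z i else 0ℤ) (I≗J i))
    respects : ∀ {I J} → (∀ i → I i ≡ J i) → NoZeroPart I → NoZeroPart J
    respects I≗J noZero (i , t) (j , f) zero-sum =
      noZero (i , trans (I≗J i) t) (j , trans (I≗J j) f) (trans (sumOver-cong I≗J) zero-sum)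
    noZeroPart : ∀ I → ⟦ noZeroPartQF c I ⟧ℤ a ⇔ NoZeroPart I
    noZeroPart I =
      ⇔.trans (¬-cong-⇔ (⟦decide⟧ (em {Proper I}) ×-⇔
                          ⇔.trans mod-0 (mk⇔ (trans (sym partial-sum)) (trans partial-sum))))
              (mk⇔ (λ ¬both t f s → ¬both ((t , f) , s)) (λ noZero ((t , f) , s) → noZero t f s))
      where
      partial-sum : dot (λ i → if I i then signℤ (c i) else 0ℤ) a ≡ sumOver I z
      partial-sum = sumℤ-cong (λ i → if-*ˡ (I i) (signℤ (c i)) (a i))
  definingQF-correct (inj₂ (n , ρ)) a =
    mk⇔ (λ (q , e) → q , trans (sym (dot-unitVector zero a)) (trans e (ℤP.+-comm (+ toℕ ρ) (+ suc n * q))))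
        (λ (q , e) → q , trans (dot-unitVector zero a) (trans e (ℤP.+-comm (+ suc n * q) (+ toℕ ρ))))

module _ (em : ExcludedMiddle 0ℓ) (A : Pred ℤ 0ℓ) where

  qfRelation : ∀ {n K} → QF (suc n) → (Fin (suc n) → Fin K) → Formula (relSig IndSym indAr) K
  qfRelation ψ vs = rel (qfSymbol ψ) (var ∘ vs)

  Sat-qfRelation : ∀ {n K} (ψ : QF (suc n)) vs ρ (a : Vector ℤ (suc n)) → (∀ j → proj₁ (ρ (vs j)) ≡ a j) →
    Sat (relSig IndSym indAr) (AZ A) (qfRelation {K = K} ψ vs) ρ ⇔ ⟦ ψ ⟧ℤ a
  Sat-qfRelation ψ vs ρ a ρ∘vs≗a = ⇔.trans (indI-qfSymbol ψ _) (⟦⟧ℤ-cong ψ ρ∘vs≗a)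

  -- The two clauses agree; splitting s only makes ar0C s reduce to a successor.
  AZ0C-relations-in-AZ : RelationsDefinable A I0C indI
  AZ0C-relations-in-AZ s@(inj₁ _) vs = qfRelation (definingQF em s) vs , λ ρ a ρ∘vs≗a →
    ⇔.trans (Sat-qfRelation (definingQF em s) vs ρ a ρ∘vs≗a) (definingQF-correct em s a)
  AZ0C-relations-in-AZ s@(inj₂ _) vs = qfRelation (definingQF em s) vs , λ ρ a ρ∘vs≗a →
    ⇔.trans (Sat-qfRelation (definingQF em s) vs ρ a ρ∘vs≗a) (definingQF-correct em s a)

-- Relations of A^𝒵 are definable in A^𝒵_0

L₀ : Signature
L₀ = relSig Sym0C ar0C

signOf : ℤ → Sign
signOf (+ _)    = pos
signOf -[1+ _ ] = neg

∣∣*signOf : ∀ c x → + ∣ c ∣ * (signℤ (signOf c) * x) ≡ c * x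
∣∣*signOf (+ n)    x = cong (+ n *_) (ℤP.*-identityˡ x)
∣∣*signOf -[1+ n ] x = l (+ suc n) x
  where
  l : ∀ a x → a * (-1ℤ * x) ≡ (- a) * x
  l = solve-∀

+-part≤ : ∀ {a b n f} → a ℕ.+ b ≡ n → 1 ℕ.≤ b → n ℕ.≤ suc f → a ℕ.≤ f
+-part≤ {a} {b} a+b≡n 1≤b n≤1+f = ℕP.≤-pred (begin
  suc a     ≡⟨ ℕP.+-comm 1 a ⟩
  a ℕ.+ 1   ≤⟨ ℕP.+-monoʳ-≤ a 1≤b ⟩
  a ℕ.+ b   ≡⟨ a+b≡n ⟩
  _         ≤⟨ n≤1+f ⟩
  suc _     ∎)
  where open ℕP.≤-Reasoning

module _ (em : ExcludedMiddle 0ℓ) (A : Pred ℤ 0ℓ) {K : ℕ} where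

  private
    value : Vector (Elt A) K → Fin K → ℤ
    value ρ v = proj₁ (ρ v)

  ⟦_⟧₀ : Prop (Formula L₀ K) → Vector (Elt A) K → Set
  ⟦ φ ⟧₀ ρ = ⟦ φ ⟧ (λ ψ → Sat L₀ (AZ0C A) ψ ρ)

  congruenceQF : ∀ k {N} → Vector ℤ N → (Fin N → Fin K) → ℤ → Prop (Formula L₀ K)
  congruenceQF k {zero}  c vs r = decide (em {0ℤ ≡ r [mod + suc k ]})
  congruenceQF k {suc N} c vs r = ⋁ (allFin (suc k)) λ ρ →
    atom (rel (inj₂ (k , ρ)) (λ _ → var (vs zero))) ∧ᵖ congruenceQF k (tail c) (tail vs) (r - c zero * + toℕ ρ)

  congruenceQF-correct : ∀ k {N} (c : Vector ℤ N) vs r ρ →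
    ⟦ congruenceQF k c vs r ⟧₀ ρ ⇔ dot c (value ρ ∘ vs) ≡ r [mod + suc k ]
  congruenceQF-correct k {zero}  c vs r ρ = ⟦decide⟧ em
  congruenceQF-correct k {suc N} c vs r ρ = begin
    ⟦ congruenceQF k c vs r ⟧₀ ρ
      ≈⟨ ⟦⋁allFin⟧ (suc k) _ ⟩
    (∃[ i ] InCongClass (k , i) (value ρ (vs zero))
          × ⟦ congruenceQF k (tail c) (tail vs) (r - c zero * + toℕ i) ⟧₀ ρ)
      ≈⟨ ∃-⇔ (λ i → ⇔.refl ×-⇔ congruenceQF-correct k (tail c) (tail vs) _ ρ) ⟩
    (∃[ i ] InCongClass (k , i) (value ρ (vs zero))
          × dot (tail c) (value ρ ∘ tail vs) ≡ r - c zero * + toℕ i [mod + suc k ])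
      ≈⟨ ⇔.sym (mod-byResidue k (c zero) _ _ r) ⟩
    dot c (value ρ ∘ vs) ≡ r [mod + suc k ] ∎
    where open import Relation.Binary.Reasoning.Setoid (⇔-setoid 0ℓ)

  signedValue : Vector (Elt A) K → Sign × Fin K → ℤ
  signedValue ρ e = signℤ (proj₁ e) * value ρ (proj₂ e)

  signedSum : Vector (Elt A) K → List (Sign × Fin K) → ℤ
  signedSum ρ = listSum (signedValue ρ)

  nonDegenerate : Sign × Fin K → List (Sign × Fin K) → ℤ → Formula L₀ K
  nonDegenerate e es r =
    rel (inj₁ (length es , r , proj₁ ∘ List.lookup (e ∷ es))) (var ∘ proj₂ ∘ List.lookup (e ∷ es))

  sumQF : ℕ → List (Sign × Fin K) → ℤ → Prop (Formula L₀ K)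
  sumQF _       []       r = decide (r ℤ.≟ 0ℤ)
  sumQF zero    (_ ∷ _)  r = ⊥ᵖ
  sumQF (suc f) (e ∷ es) r =
    atom (nonDegenerate e es r) ∨ᵖ ⋁ (splits (e ∷ es)) (λ (es₁ , es₂) → sumQF f es₁ 0ℤ ∧ᵖ sumQF f es₂ r)

  sumQF-sound : ∀ f es r ρ → ⟦ sumQF f es r ⟧₀ ρ → signedSum ρ es ≡ r
  sumQF-sound _       []       r ρ r≡0 = sym (to (⟦decide⟧ (r ℤ.≟ 0ℤ)) r≡0)
  sumQF-sound (suc f) (e ∷ es) r ρ (inj₁ nonDeg) =
    trans (sym (listSum-lookup (signedValue ρ) (e ∷ es))) (proj₁ nonDeg)
  sumQF-sound (suc f) (e ∷ es) r ρ (inj₂ bySplit) =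
    viaSplit (splits-listSum (signedValue ρ) (e ∷ es)) (to (⟦⋁⟧ (splits (e ∷ es)) _) bySplit)
    where
    viaSplit : ∀ {ps} → All (λ (es₁ , es₂) → signedSum ρ es₁ + signedSum ρ es₂ ≡ signedSum ρ (e ∷ es)) ps →
               Any (λ (es₁ , es₂) → ⟦ sumQF f es₁ 0ℤ ∧ᵖ sumQF f es₂ r ⟧₀ ρ) ps → signedSum ρ (e ∷ es) ≡ r
    viaSplit {(es₁ , es₂) ∷ _} (split-sum ∷ _) (here (part , rest)) =
      trans (sym split-sum)
            (trans (cong₂ _+_ (sumQF-sound f es₁ 0ℤ ρ part) (sumQF-sound f es₂ r ρ rest)) (ℤP.+-identityˡ r))
    viaSplit (_ ∷ sums) (there later) = viaSplit sums later

  sumQF-complete : ∀ f es r ρ → length es ℕ.≤ f → signedSum ρ es ≡ r → ⟦ sumQF f es r ⟧₀ ρ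
  sumQF-complete _       []       r ρ _  sum≡r = from (⟦decide⟧ (r ℤ.≟ 0ℤ)) (sym sum≡r)
  sumQF-complete (suc f) (e ∷ es) r ρ es≤f sum≡r with em {∃[ I ] Proper I × sumOver I z ≡ 0ℤ}
    where z = signedValue ρ ∘ List.lookup (e ∷ es)
  ... | no noZeroPart = inj₁ (trans (listSum-lookup (signedValue ρ) (e ∷ es)) sum≡r ,
                              λ I true∈I false∈I zero-sum → noZeroPart (I , (true∈I , false∈I) , zero-sum))
  ... | yes (I , (true∈I , false∈I) , zero-sum) =
    inj₂ (from (⟦⋁⟧ (splits (e ∷ es)) _) (Any.map (λ { refl → part-complete , rest-complete }) split∈splits))
    where
    L = e ∷ es
    split∈splits = pick-unpick∈splits L I
    part-sum : signedSum ρ (pick L I) ≡ 0ℤ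
    part-sum = trans (sym (sumOver-lookup (signedValue ρ) L I)) zero-sum
    rest-sum : signedSum ρ (unpick L I) ≡ r
    rest-sum = begin
      signedSum ρ (unpick L I)                           ≡⟨ ℤP.+-identityˡ _ ⟨
      0ℤ + signedSum ρ (unpick L I)                      ≡⟨ cong (_+ signedSum ρ (unpick L I)) part-sum ⟨
      signedSum ρ (pick L I) + signedSum ρ (unpick L I)  ≡⟨ All.lookup (splits-listSum (signedValue ρ) L) split∈splits ⟩
      signedSum ρ L                                      ≡⟨ sum≡r ⟩
      r                                                  ∎
      where open ≡-Reasoning
    part-complete = sumQF-complete f (pick L I) 0ℤ ρ
      (+-part≤ (length-pick-unpick L I) (unpick-nonempty L I false∈I) es≤f) part-sum
    rest-complete = sumQF-complete f (unpick L I) r ρ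
      (+-part≤ (trans (ℕP.+-comm (length (unpick L I)) _) (length-pick-unpick L I)) (pick-nonempty L I true∈I) es≤f)
      rest-sum

  expand : ∀ {N} → Vector ℤ N → (Fin N → Fin K) → List (Sign × Fin K)
  expand {zero}  c vs = []
  expand {suc N} c vs = replicate ∣ c zero ∣ (signOf (c zero) , vs zero) ++ expand (tail c) (tail vs)

  listSum-expand : ∀ {N} (c : Vector ℤ N) vs ρ → signedSum ρ (expand c vs) ≡ dot c (value ρ ∘ vs)
  listSum-expand {zero}  c vs ρ = refl
  listSum-expand {suc N} c vs ρ = trans (listSum-++ (signedValue ρ) (replicate ∣ c zero ∣ _) _)
    (cong₂ _+_ (trans (listSum-replicate (signedValue ρ) ∣ c zero ∣ _) (∣∣*signOf (c zero) _))
               (listSum-expand (tail c) (tail vs) ρ))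

  linCongQF : ∀ {N} → LinCong N → (Fin N → Fin K) → Prop (Formula L₀ K)
  linCongQF (lincong (+ zero)   c r) vs = sumQF (length (expand c vs)) (expand c vs) r
  linCongQF (lincong (+ suc k)  c r) vs = congruenceQF k c vs r
  linCongQF (lincong -[1+ k ]   c r) vs = congruenceQF k c vs r

  linCongQF-correct : ∀ {N} (a : LinCong N) vs ρ → ⟦ linCongQF a vs ⟧₀ ρ ⇔ a holdsAt (value ρ ∘ vs)
  linCongQF-correct (lincong (+ zero) c r) vs ρ = ⇔.trans
    (mk⇔ (trans (sym (listSum-expand c vs ρ)) ∘ sumQF-sound _ (expand c vs) r ρ)
         (sumQF-complete _ (expand c vs) r ρ ℕP.≤-refl ∘ trans (listSum-expand c vs ρ)))
    (⇔.sym mod-0)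
  linCongQF-correct (lincong (+ suc k) c r) vs ρ = congruenceQF-correct k c vs r ρ
  linCongQF-correct (lincong -[1+ k ]  c r) vs ρ = ⇔.trans (congruenceQF-correct k c vs r ρ) (⇔.sym mod-neg)

module _ (em : ExcludedMiddle 0ℓ) (A : Pred ℤ 0ℓ) where

  AZ-relations-in-AZ0C : RelationsDefinable A indI I0C
  AZ-relations-in-AZ0C (n , m , φ , b) {K} vs = toFormula id ψ , λ ρ a ρ∘vs≗a → begin
    Sat L₀ (AZ0C A) (toFormula id ψ) ρ
      ≈⟨ Sat-toFormula id (AZ0C A) ψ ρ ⟩
    ⟦ ψ ⟧ (λ χ → Sat L₀ (AZ0C A) χ ρ)
      ≈⟨ ⟦>>=⟧ (qe φ) _ ⟩
    ⟦ qe φ ⟧ (λ a′ → ⟦ linCongQF em A (fixParams b a′) vs ⟧ (λ χ → Sat L₀ (AZ0C A) χ ρ))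
      ≈⟨ ⟦⟧-cong′ (qe φ) (λ a′ → ⇔.trans (linCongQF-correct em A (fixParams b a′) vs ρ)
                                (⇔.trans (holdsAt-cong (fixParams b a′) ρ∘vs≗a) (fixParams-holds b a′ a))) ⟩
    ⟦ qe φ ⟧ℤ (a ++ᵥ b)
      ≈⟨ qe-correct em φ (a ++ᵥ b) ⟩
    Sat ZSig 𝒵 φ (a ++ᵥ b) ∎
    where
    open import Relation.Binary.Reasoning.Setoid (⇔-setoid 0ℓ)
    ψ : Prop (Formula L₀ K)
    ψ = qe φ >>= λ a′ → linCongQF em A (fixParams b a′) vs

proposition2p11 : ExcludedMiddle 0ℓ → (A : Pred ℤ 0ℓ) →
    Interdefinable (AZ A) (AZ0C A) refl
proposition2p11 em A k X =
  mk⇔ (definable-transfer A indI I0C (AZ-relations-in-AZ0C em A) k X)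
      (definable-transfer A I0C indI (AZ0C-relations-in-AZ em A) k X)
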